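{- Let $0\le R\le1$, $r=R(1-R)$, $\sigma_1=-\frac18-r$, $\sigma_3=\frac{1}{192}+\frac16 r^2$, $\sigma_5=-\frac{1}{640}-\frac{1}{30}r^2-\frac{1}{15}r^3$, and for integers $k\ge8$ let $$\tilde\varrho_k=\frac{\frac12-\left(\frac12\right)^k}{k}+\frac{R-R^k}{k}+\frac{(1-R)-(1-R)^k}{k}+\sigma_1+\binom{k-1}{2}\sigma_3+\binom{k-1}{4}\sigma_5 .$$ Then $\tilde\varrho_k<0$ for all $k\ge8$. -}

module Defs where

open import Level using (Level; _⊔_; suc)
open import Data.Nat as ℕ using (ℕ; zero)
open import Data.Nat.Combinatorics using (_C_)
open import Data.Sum using (_⊎_)
open import Algebra.Bundles using (CommutativeRing)
open import Relation.Binary.Core using (Rel)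
open import Relation.Binary.Structures using (IsStrictTotalOrder)
open import Relation.Nullary using (¬_)

-- An ordered field: a commutative ring with a strict total order compatible
-- with + and *, with 0 < 1, and with multiplicative inverses of nonzero
-- elements (inv is total; its value at 0 is unconstrained).
-- The real numbers are the intended instance.
record OrderedField (c ℓ₁ ℓ₂ : Level) : Set (Level.suc (c ⊔ ℓ₁ ⊔ ℓ₂)) where
  field
    commutativeRing : CommutativeRing c ℓ₁
  open CommutativeRing commutativeRing public
  infix 4 _<_
  field
    _<_                : Rel Carrier ℓ₂
    isStrictTotalOrder : IsStrictTotalOrder _≈_ _<_
    +-mono-<           : ∀ {x y} z → x < y → x + z < y + z
    *-pos              : ∀ {x y} → 0# < x → 0# < y → 0# < x * y
    0<1                : 0# < 1#
    inv                : Carrier → Carrier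
    inv-r              : ∀ x → ¬ (x ≈ 0#) → x * inv x ≈ 1#

  infix 4 _≤_
  _≤_ : Rel Carrier (ℓ₁ ⊔ ℓ₂)
  x ≤ y = (x < y) ⊎ (x ≈ y)

module OrderedFieldOps {c ℓ₁ ℓ₂} (F : OrderedField c ℓ₁ ℓ₂) where
  open OrderedField F

  fromℕ : ℕ → Carrier
  fromℕ zero        = 0#
  fromℕ (ℕ.suc n)   = 1# + fromℕ n

  pow : Carrier → ℕ → Carrier
  pow x zero      = 1#
  pow x (ℕ.suc n) = x * pow x n

  _/ℕ_ : Carrier → ℕ → Carrier
  x /ℕ n = x * inv (fromℕ n)

  half : Carrier
  half = 1# /ℕ 2

  rr : Carrier → Carrier
  rr R = R * (1# - R)

  σ₁ : Carrier → Carrier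
  σ₁ R = - (1# /ℕ 8) - rr R

  σ₃ : Carrier → Carrier
  σ₃ R = (1# /ℕ 192) + (pow (rr R) 2 /ℕ 6)

  σ₅ : Carrier → Carrier
  σ₅ R = - (1# /ℕ 640) - (pow (rr R) 2 /ℕ 30) - (pow (rr R) 3 /ℕ 15)

  ϱ̃ : Carrier → ℕ → Carrier
  ϱ̃ R k =
      ((half - pow half k) /ℕ k)
    + ((R - pow R k) /ℕ k)
    + (((1# - R) - pow (1# - R) k) /ℕ k)
    + σ₁ R
    + fromℕ ((k ℕ.∸ 1) C 2) * σ₃ R
    + fromℕ ((k ℕ.∸ 1) C 4) * σ₅ R

Lemma9Claim : ∀ {c ℓ₁ ℓ₂} → OrderedField c ℓ₁ ℓ₂ → Set (c ⊔ ℓ₁ ⊔ ℓ₂)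
Lemma9Claim F =
  ∀ (R : Carrier) → 0# ≤ R → R ≤ 1# →
  ∀ (k : ℕ) → 8 ℕ.≤ k → ϱ̃ R k < 0#
  where open OrderedField F
        open OrderedFieldOps F

-- Multiplying by 1920·k clears every denominator of ϱ̃_k. Writing r = R(1−R), P = (1/2)^k and
-- D_k = R^k + (1−R)^k + kr − 1, this gives
--   1920·k·ϱ̃_k = 960 − 240k − 1920(P + D_k) + k(C(k−1,2)(10 + 320r²) − C(k−1,4)(3 + 64r² + 128r³)).
-- The defect D_k is nonnegative, since D_{k+1} = D_k + r(1 − R^{k−1} − (1−R)^{k−1}).
-- For k ≥ 12 we have C(k−1,4) ≥ 5·C(k−1,2), so the binomial part is at most −C(k−1,2)(5 + 640r³),
-- while 960 − 240k < 0. For 8 ≤ k ≤ 11 the right-hand side is a polynomial in R, equal to −1920P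
-- minus a polynomial with nonnegative coefficients in r and (1−2R)² = 1 − 4r.

module Submission where

open import Defs

open import Data.Nat as ℕ using (ℕ; zero; suc; _∸_)
open import Data.Nat.Combinatorics using (_C_; nCk+nC[k+1]≡[n+1]C[k+1]; nC1≡n)
open import Data.Product using (_×_; _,_; proj₂)
import Data.Nat.Properties as ℕP
open import Data.Integer as ℤ using (ℤ; +_; -[1+_]; _⊖_; _◃_; sign; ∣_∣)
import Data.Integer.Properties as ℤP
open import Data.Sign as Sign using (Sign)
open import Data.Maybe using (Maybe; just; nothing)
open import Relation.Nullary using (¬_; yes; no; contradiction)
open import Data.Sum using (inj₁; inj₂)
open import Relation.Binary.Definitions using (tri<; tri≈; tri>)
open import Relation.Binary.Structures using (IsStrictTotalOrder)
import Relation.Binary.PropositionalEquality as ≡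
open ≡ using (_≡_)
open import Algebra.Solver.Ring.AlmostCommutativeRing
  using (fromCommutativeRing; _-Raw-AlmostCommutative⟶_)

5*C₂≤C₄ : ∀ m → let n = 11 ℕ.+ m in 5 ℕ.* (n C 2) ℕ.≤ n C 4
5*C₂≤C₄ m = proj₂ (proj₂ (binomialBounds m))
  where
  pascal : ∀ n k → suc n C suc k ≡ n C k ℕ.+ n C suc k
  pascal n k = ≡.sym (nCk+nC[k+1]≡[n+1]C[k+1] n k)

  binomialBounds : ∀ m → let n = 11 ℕ.+ m in
    (5 ℕ.≤ n C 2) × (5 ℕ.* n ℕ.≤ n C 3) × (5 ℕ.* (n C 2) ℕ.≤ n C 4)
  binomialBounds zero = ℕP.≤ᵇ⇒≤ 5 55 _ , ℕP.≤ᵇ⇒≤ 55 165 _ , ℕP.≤ᵇ⇒≤ 275 330 _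
  binomialBounds (suc m) with binomialBounds m
  ... | 5≤C₂ , 5n≤C₃ , 5C₂≤C₄ = 5≤C₂′ , 5n≤C₃′ , 5C₂≤C₄′
    where
    open ℕP.≤-Reasoning
    n : ℕ
    n = 11 ℕ.+ m
    5≤C₂′ : 5 ℕ.≤ suc n C 2
    5≤C₂′ = begin
      5                   ≤⟨ 5≤C₂ ⟩
      n C 2               ≤⟨ ℕP.m≤n+m (n C 2) (n C 1) ⟩
      n C 1 ℕ.+ n C 2     ≡⟨ pascal n 1 ⟨
      suc n C 2           ∎
    5n≤C₃′ : 5 ℕ.* suc n ℕ.≤ suc n C 3
    5n≤C₃′ = begin
      5 ℕ.* suc n         ≡⟨ ℕP.*-suc 5 n ⟩
      5 ℕ.+ 5 ℕ.* n       ≤⟨ ℕP.+-mono-≤ 5≤C₂ 5n≤C₃ ⟩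
      n C 2 ℕ.+ n C 3     ≡⟨ pascal n 2 ⟨
      suc n C 3           ∎
    5C₂≤C₄′ : 5 ℕ.* (suc n C 2) ℕ.≤ suc n C 4
    5C₂≤C₄′ = begin
      5 ℕ.* (suc n C 2)             ≡⟨ ≡.cong (5 ℕ.*_) (≡.trans (pascal n 1) (≡.cong (ℕ._+ n C 2) (nC1≡n n))) ⟩
      5 ℕ.* (n ℕ.+ n C 2)           ≡⟨ ℕP.*-distribˡ-+ 5 n (n C 2) ⟩
      5 ℕ.* n ℕ.+ 5 ℕ.* (n C 2)     ≤⟨ ℕP.+-mono-≤ 5n≤C₃ 5C₂≤C₄ ⟩
      n C 3 ℕ.+ n C 4               ≡⟨ pascal n 3 ⟨
      suc n C 4                     ∎

module Lemma9 {c ℓ₁ ℓ₂} (F : OrderedField c ℓ₁ ℓ₂) where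
  open OrderedField F
  open OrderedFieldOps F
  open import Algebra.Properties.Ring ring
    using (-‿involutive; -0#≈0#; -‿distribˡ-*; -‿distribʳ-*; -‿+-comm)
  open import Relation.Binary.Reasoning.Setoid setoid
  open import Algebra.Properties.CommutativeSemigroup +-commutativeSemigroup
    using () renaming (interchange to +-interchange)

  fromℕ-+ : ∀ m n → fromℕ (m ℕ.+ n) ≈ fromℕ m + fromℕ n
  fromℕ-+ zero    n = sym (+-identityˡ _)
  fromℕ-+ (suc m) n = trans (+-congˡ (fromℕ-+ m n)) (sym (+-assoc _ _ _))

  fromℕ-* : ∀ m n → fromℕ (m ℕ.* n) ≈ fromℕ m * fromℕ n
  fromℕ-* zero    n = sym (zeroˡ _)
  fromℕ-* (suc m) n = begin
    fromℕ (n ℕ.+ m ℕ.* n)       ≈⟨ fromℕ-+ n (m ℕ.* n) ⟩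
    fromℕ n + fromℕ (m ℕ.* n)   ≈⟨ +-cong (sym (*-identityˡ _)) (fromℕ-* m n) ⟩
    1# * fromℕ n + fromℕ m * fromℕ n ≈⟨ distribʳ _ _ _ ⟨
    (1# + fromℕ m) * fromℕ n    ∎

  -- + 1 is sent to 1# itself rather than to fromℕ 1 = 1# + 0#, so that the
  -- solver's constant 1 is literally the 1# occurring in the definitions.
  fromℤ : ℤ → Carrier
  fromℤ (+ 1)      = 1#
  fromℤ (+ n)      = fromℕ n
  fromℤ -[1+ n ]   = - fromℕ (suc n)

  fromℤ-+ : ∀ n → fromℤ (+ n) ≈ fromℕ n
  fromℤ-+ zero          = refl
  fromℤ-+ (suc zero)    = sym (+-identityʳ 1#)
  fromℤ-+ (suc (suc n)) = refl

  signed : Sign → Carrier → Carrier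
  signed Sign.+ x = x
  signed Sign.- x = - x

  fromℤ-◃ : ∀ s n → fromℤ (s ◃ n) ≈ signed s (fromℕ n)
  fromℤ-◃ Sign.+ zero    = refl
  fromℤ-◃ Sign.- zero    = sym -0#≈0#
  fromℤ-◃ Sign.+ (suc n) = fromℤ-+ (suc n)
  fromℤ-◃ Sign.- (suc n) = refl

  fromℤ-sign-abs : ∀ i → fromℤ i ≈ signed (sign i) (fromℕ ∣ i ∣)
  fromℤ-sign-abs i = begin
    fromℤ i                           ≡⟨ ≡.cong fromℤ (ℤP.◃-inverse i) ⟨
    fromℤ (sign i ◃ ∣ i ∣)            ≈⟨ fromℤ-◃ (sign i) ∣ i ∣ ⟩
    signed (sign i) (fromℕ ∣ i ∣)     ∎

  signed-cong : ∀ s {x y} → x ≈ y → signed s x ≈ signed s y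
  signed-cong Sign.+ x≈y = x≈y
  signed-cong Sign.- x≈y = -‿cong x≈y

  signed-* : ∀ s t x y → signed (s Sign.* t) (x * y) ≈ signed s x * signed t y
  signed-* Sign.+ Sign.+ x y = refl
  signed-* Sign.+ Sign.- x y = -‿distribʳ-* x y
  signed-* Sign.- Sign.+ x y = -‿distribˡ-* x y
  signed-* Sign.- Sign.- x y = begin
    x * y             ≈⟨ -‿involutive (x * y) ⟨
    - - (x * y)       ≈⟨ -‿cong (-‿distribʳ-* x y) ⟩
    - (x * - y)       ≈⟨ -‿distribˡ-* x (- y) ⟩
    - x * - y         ∎

  fromℤ-⊖ : ∀ m n → fromℤ (m ⊖ n) ≈ fromℕ m - fromℕ n
  fromℤ-⊖ zero    zero    = sym (trans (+-identityˡ _) -0#≈0#)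
  fromℤ-⊖ zero    (suc n) = sym (+-identityˡ _)
  fromℤ-⊖ (suc m) zero    = trans (fromℤ-+ (suc m)) (sym (trans (+-congˡ -0#≈0#) (+-identityʳ _)))
  fromℤ-⊖ (suc m) (suc n) = begin
    fromℤ (suc m ⊖ suc n)          ≡⟨ ≡.cong fromℤ (ℤP.[1+m]⊖[1+n]≡m⊖n m n) ⟩
    fromℤ (m ⊖ n)                  ≈⟨ fromℤ-⊖ m n ⟩
    fromℕ m - fromℕ n              ≈⟨ +-identityˡ _ ⟨
    0# + (fromℕ m - fromℕ n)       ≈⟨ +-congʳ (-‿inverseʳ 1#) ⟨
    (1# - 1#) + (fromℕ m - fromℕ n) ≈⟨ +-interchange 1# (- 1#) (fromℕ m) (- fromℕ n) ⟩
    fromℕ (suc m) + (- 1# - fromℕ n) ≈⟨ +-congˡ (-‿+-comm 1# (fromℕ n)) ⟩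
    fromℕ (suc m) - fromℕ (suc n)  ∎

  fromℤ-+-homo : ∀ i j → fromℤ (i ℤ.+ j) ≈ fromℤ i + fromℤ j
  fromℤ-+-homo -[1+ m ] -[1+ n ] = begin
    - fromℕ (suc (suc (m ℕ.+ n)))      ≡⟨ ≡.cong (λ k → - fromℕ k) (ℕP.+-suc (suc m) n) ⟨
    - fromℕ (suc m ℕ.+ suc n)          ≈⟨ -‿cong (fromℕ-+ (suc m) (suc n)) ⟩
    - (fromℕ (suc m) + fromℕ (suc n))  ≈⟨ -‿+-comm _ _ ⟨
    - fromℕ (suc m) - fromℕ (suc n)    ∎
  fromℤ-+-homo -[1+ m ] (+ n) = begin
    fromℤ (n ⊖ suc m)                  ≈⟨ fromℤ-⊖ n (suc m) ⟩
    fromℕ n - fromℕ (suc m)            ≈⟨ +-comm _ _ ⟩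
    - fromℕ (suc m) + fromℕ n          ≈⟨ +-congˡ (fromℤ-+ n) ⟨
    - fromℕ (suc m) + fromℤ (+ n)      ∎
  fromℤ-+-homo (+ m) -[1+ n ] = trans (fromℤ-⊖ m (suc n)) (+-congʳ (sym (fromℤ-+ m)))
  fromℤ-+-homo (+ m) (+ n) = begin
    fromℤ (+ (m ℕ.+ n))                ≈⟨ fromℤ-+ (m ℕ.+ n) ⟩
    fromℕ (m ℕ.+ n)                    ≈⟨ fromℕ-+ m n ⟩
    fromℕ m + fromℕ n                  ≈⟨ +-cong (fromℤ-+ m) (fromℤ-+ n) ⟨
    fromℤ (+ m) + fromℤ (+ n)          ∎

  fromℤ-*-homo : ∀ i j → fromℤ (i ℤ.* j) ≈ fromℤ i * fromℤ j
  fromℤ-*-homo i j = begin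
    fromℤ (s ◃ ∣ i ∣ ℕ.* ∣ j ∣)                                   ≈⟨ fromℤ-◃ s (∣ i ∣ ℕ.* ∣ j ∣) ⟩
    signed s (fromℕ (∣ i ∣ ℕ.* ∣ j ∣))                            ≈⟨ signed-cong s (fromℕ-* ∣ i ∣ ∣ j ∣) ⟩
    signed s (fromℕ ∣ i ∣ * fromℕ ∣ j ∣)                          ≈⟨ signed-* (sign i) (sign j) _ _ ⟩
    signed (sign i) (fromℕ ∣ i ∣) * signed (sign j) (fromℕ ∣ j ∣)
      ≈⟨ *-cong (fromℤ-sign-abs i) (fromℤ-sign-abs j) ⟨
    fromℤ i * fromℤ j                                             ∎
    where
    s : Sign
    s = sign i Sign.* sign j

  fromℤ-‿homo : ∀ i → fromℤ (ℤ.- i) ≈ - fromℤ i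
  fromℤ-‿homo -[1+ n ]      = trans (fromℤ-+ (suc n)) (sym (-‿involutive _))
  fromℤ-‿homo (+ zero)      = sym -0#≈0#
  fromℤ-‿homo (+ suc zero)  = -‿cong (+-identityʳ 1#)
  fromℤ-‿homo (+ suc (suc n)) = refl

  fromℤ-morphism : ℤ.+-*-rawRing -Raw-AlmostCommutative⟶ fromCommutativeRing commutativeRing
  fromℤ-morphism = record
    { ⟦_⟧    = fromℤ
    ; +-homo = fromℤ-+-homo
    ; *-homo = fromℤ-*-homo
    ; -‿homo = fromℤ-‿homo
    ; 0-homo = refl
    ; 1-homo = refl
    }

  fromℤ-equal? : ∀ i j → Maybe (fromℤ i ≈ fromℤ j)
  fromℤ-equal? i j with i ℤ.≟ j
  ... | yes ≡.refl = just refl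
  ... | no _       = nothing

  open import Algebra.Solver.Ring ℤ.+-*-rawRing (fromCommutativeRing commutativeRing) fromℤ-morphism fromℤ-equal?

  infix 10 #_
  #_ : ∀ {n} → ℕ → Polynomial n
  # k = con (+ k)

  open IsStrictTotalOrder isStrictTotalOrder
    using (compare; irrefl; <-respˡ-≈; <-respʳ-≈) renaming (trans to <-trans)

  ≤-<-trans : ∀ {x y z} → x ≤ y → y < z → x < z
  ≤-<-trans (inj₁ x<y) y<z = <-trans x<y y<z
  ≤-<-trans (inj₂ x≈y) y<z = <-respˡ-≈ (sym x≈y) y<z

  ≤-respʳ-≈ : ∀ {x y z} → x ≤ y → y ≈ z → x ≤ z
  ≤-respʳ-≈ (inj₁ x<y) y≈z = inj₁ (<-respʳ-≈ y≈z x<y)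
  ≤-respʳ-≈ (inj₂ x≈y) y≈z = inj₂ (trans x≈y y≈z)

  pos-+-nonneg : ∀ {x y} → 0# < x → 0# ≤ y → 0# < x + y
  pos-+-nonneg {x} {y} 0<x 0≤y =
    ≤-<-trans (≤-respʳ-≈ 0≤y (sym (+-identityˡ y))) (+-mono-< y 0<x)

  nonneg-+ : ∀ {x y} → 0# ≤ x → 0# ≤ y → 0# ≤ x + y
  nonneg-+ (inj₁ 0<x) 0≤y = inj₁ (pos-+-nonneg 0<x 0≤y)
  nonneg-+ {x} {y} (inj₂ 0≈x) 0≤y = ≤-respʳ-≈ 0≤y (trans (sym (+-identityˡ y)) (+-congʳ 0≈x))

  nonneg-* : ∀ {x y} → 0# ≤ x → 0# ≤ y → 0# ≤ x * y
  nonneg-* (inj₁ 0<x) (inj₁ 0<y) = inj₁ (*-pos 0<x 0<y)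
  nonneg-* {x} {y} (inj₁ _) (inj₂ 0≈y) = inj₂ (sym (trans (*-congˡ (sym 0≈y)) (zeroʳ x)))
  nonneg-* {x} {y} (inj₂ 0≈x) _ = inj₂ (sym (trans (*-congʳ (sym 0≈x)) (zeroˡ y)))

  pow-nonneg : ∀ {x} n → 0# ≤ x → 0# ≤ pow x n
  pow-nonneg zero    _   = inj₁ 0<1
  pow-nonneg (suc n) 0≤x = nonneg-* 0≤x (pow-nonneg n 0≤x)

  fromℕ-nonneg : ∀ n → 0# ≤ fromℕ n
  fromℕ-nonneg zero    = inj₂ refl
  fromℕ-nonneg (suc n) = inj₁ (pos-+-nonneg 0<1 (fromℕ-nonneg n))

  fromℕ-pos : ∀ n .{{_ : ℕ.NonZero n}} → 0# < fromℕ n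
  fromℕ-pos (suc n) = pos-+-nonneg 0<1 (fromℕ-nonneg n)

  neg-pos : ∀ {x} → x < 0# → 0# < - x
  neg-pos {x} x<0 = <-respʳ-≈ (+-identityˡ (- x)) (<-respˡ-≈ (-‿inverseʳ x) (+-mono-< (- x) x<0))

  pos-neg : ∀ {x} → 0# < x → - x < 0#
  pos-neg {x} 0<x = <-respʳ-≈ (-‿inverseʳ x) (<-respˡ-≈ (+-identityˡ (- x)) (+-mono-< (- x) 0<x))

  square-nonneg : ∀ x → 0# ≤ pow x 2
  square-nonneg x with compare x 0#
  ... | tri< x<0 _ _ = inj₁ (<-respʳ-≈ (-x*-x≈x*x) (*-pos (neg-pos x<0) (*-pos (neg-pos x<0) 0<1)))
    where
    -x*-x≈x*x : - x * (- x * 1#) ≈ x * (x * 1#)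
    -x*-x≈x*x = solve 1 (λ x → :- x :* (:- x :* # 1) := x :* (x :* # 1)) refl x
  ... | tri≈ _ x≈0 _ = inj₂ (sym (trans (*-congʳ x≈0) (zeroˡ _)))
  ... | tri> _ _ 0<x = inj₁ (*-pos 0<x (*-pos 0<x 0<1))

  pos-*-cancelˡ-neg : ∀ {x y} → 0# < x → x * y < 0# → y < 0#
  pos-*-cancelˡ-neg {x} {y} 0<x xy<0 with compare y 0#
  ... | tri< y<0 _ _ = y<0
  ... | tri≈ _ y≈0 _ = contradiction xy<0 (irrefl (trans (*-congˡ y≈0) (zeroʳ x)))
  ... | tri> _ _ 0<y = contradiction (<-trans (*-pos 0<x 0<y) xy<0) (irrefl refl)

  1-x-nonneg : ∀ {x} → x ≤ 1# → 0# ≤ 1# - x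
  1-x-nonneg {x} (inj₁ x<1) = inj₁ (<-respˡ-≈ (-‿inverseʳ x) (+-mono-< (- x) x<1))
  1-x-nonneg {x} (inj₂ x≈1) = inj₂ (sym (trans (+-congˡ (-‿cong x≈1)) (-‿inverseʳ 1#)))

  nonneg-+-pos : ∀ {x y} → 0# ≤ x → 0# < y → 0# < x + y
  nonneg-+-pos {x} {y} 0≤x 0<y = <-respʳ-≈ (+-comm y x) (pos-+-nonneg 0<y 0≤x)

  pos⇒≉0 : ∀ {x} → 0# < x → ¬ (x ≈ 0#)
  pos⇒≉0 0<x x≈0 = irrefl (sym x≈0) 0<x

  inv-pos : ∀ {x} → 0# < x → 0# < inv x
  inv-pos {x} 0<x with compare (inv x) 0#
  ... | tri> _ _ 0<inv = 0<inv
  ... | tri≈ _ inv≈0 _ = contradiction 0<1 (irrefl (sym 1≈0))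
    where
    1≈0 : 1# ≈ 0#
    1≈0 = trans (sym (inv-r x (pos⇒≉0 0<x))) (trans (*-congˡ inv≈0) (zeroʳ x))
  ... | tri< inv<0 _ _ = contradiction (<-trans (pos-neg 0<1) 0<-1) (irrefl refl)
    where
    0<-1 : 0# < - 1#
    0<-1 = <-respʳ-≈ (trans (sym (-‿distribʳ-* x (inv x))) (-‿cong (inv-r x (pos⇒≉0 0<x))))
                     (*-pos 0<x (neg-pos inv<0))

  half-nonneg : 0# ≤ half
  half-nonneg = nonneg-* (inj₁ 0<1) (inj₁ (inv-pos (fromℕ-pos 2)))

  fromℕ-*-inv : ∀ n .{{_ : ℕ.NonZero n}} → fromℕ n * inv (fromℕ n) ≈ 1#
  fromℕ-*-inv n = inv-r (fromℕ n) (pos⇒≉0 (fromℕ-pos n))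

  fromℕ-*-/ℕ : ∀ a m {N} x .{{_ : ℕ.NonZero a}} → a ℕ.* m ≡ N → fromℕ N * (x /ℕ a) ≈ fromℕ m * x
  fromℕ-*-/ℕ (suc a) m x ≡.refl = begin
    fromℕ (suc a ℕ.* m) * (x * inv A)  ≈⟨ *-congʳ (fromℕ-* (suc a) m) ⟩
    A * fromℕ m * (x * inv A)
      ≈⟨ solve 4 (λ A M x I → A :* M :* (x :* I) := A :* I :* (M :* x)) refl A (fromℕ m) x (inv A) ⟩
    A * inv A * (fromℕ m * x)          ≈⟨ *-congʳ (fromℕ-*-inv (suc a)) ⟩
    1# * (fromℕ m * x)                 ≈⟨ *-identityˡ _ ⟩
    fromℕ m * x                        ∎
    where
    A : Carrier
    A = fromℕ (suc a)

  *-inv-distrib : ∀ {K I} a b c s t u → K * I ≈ 1# →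
    K * (a * I + b * I + c * I + s + t + u) ≈ a + b + c + K * (s + t + u)
  *-inv-distrib {K} {I} a b c s t u K*I≈1 = begin
    K * (a * I + b * I + c * I + s + t + u)
      ≈⟨ solve 8 (λ K I a b c s t u → K :* (a :* I :+ b :* I :+ c :* I :+ s :+ t :+ u)
                                    := K :* I :* (a :+ b :+ c) :+ K :* (s :+ t :+ u)) refl K I a b c s t u ⟩
    K * I * (a + b + c) + K * (s + t + u)
      ≈⟨ +-congʳ (trans (*-congʳ K*I≈1) (*-identityˡ _)) ⟩
    a + b + c + K * (s + t + u) ∎

  1920*half : fromℕ 1920 * half ≈ fromℕ 960
  1920*half = trans (fromℕ-*-/ℕ 2 960 1# ≡.refl) (*-identityʳ _)

  1920*σ₁ : ∀ R → fromℕ 1920 * σ₁ R ≈ - (fromℕ 240 + fromℕ 1920 * rr R)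
  1920*σ₁ R = begin
    fromℕ 1920 * (- (1# /ℕ 8) - rr R)
      ≈⟨ solve 2 (λ a r → # 1920 :* (:- a :- r) := :- (# 1920 :* a :+ # 1920 :* r)) refl (1# /ℕ 8) (rr R) ⟩
    - (fromℕ 1920 * (1# /ℕ 8) + fromℕ 1920 * rr R)
      ≈⟨ -‿cong (+-congʳ (trans (fromℕ-*-/ℕ 8 240 1# ≡.refl) (*-identityʳ _))) ⟩
    - (fromℕ 240 + fromℕ 1920 * rr R) ∎

  1920*σ₃ : ∀ R → fromℕ 1920 * σ₃ R ≈ fromℕ 10 + fromℕ 320 * pow (rr R) 2
  1920*σ₃ R = begin
    fromℕ 1920 * (1# /ℕ 192 + pow (rr R) 2 /ℕ 6)
      ≈⟨ distribˡ _ _ _ ⟩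
    fromℕ 1920 * (1# /ℕ 192) + fromℕ 1920 * (pow (rr R) 2 /ℕ 6)
      ≈⟨ +-cong (trans (fromℕ-*-/ℕ 192 10 1# ≡.refl) (*-identityʳ _))
                (fromℕ-*-/ℕ 6 320 (pow (rr R) 2) ≡.refl) ⟩
    fromℕ 10 + fromℕ 320 * pow (rr R) 2 ∎

  1920*σ₅ : ∀ R → fromℕ 1920 * σ₅ R ≈ - (fromℕ 3 + fromℕ 64 * pow (rr R) 2 + fromℕ 128 * pow (rr R) 3)
  1920*σ₅ R = begin
    fromℕ 1920 * (- (1# /ℕ 640) - pow (rr R) 2 /ℕ 30 - pow (rr R) 3 /ℕ 15)
      ≈⟨ solve 3 (λ a b c → # 1920 :* (:- a :- b :- c) := :- (# 1920 :* a :+ # 1920 :* b :+ # 1920 :* c))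
               refl (1# /ℕ 640) (pow (rr R) 2 /ℕ 30) (pow (rr R) 3 /ℕ 15) ⟩
    - (fromℕ 1920 * (1# /ℕ 640) + fromℕ 1920 * (pow (rr R) 2 /ℕ 30) + fromℕ 1920 * (pow (rr R) 3 /ℕ 15))
      ≈⟨ -‿cong (+-cong (+-cong (trans (fromℕ-*-/ℕ 640 3 1# ≡.refl) (*-identityʳ _))
                                 (fromℕ-*-/ℕ 30 64 (pow (rr R) 2) ≡.refl))
                         (fromℕ-*-/ℕ 15 128 (pow (rr R) 3) ≡.refl)) ⟩
    - (fromℕ 3 + fromℕ 64 * pow (rr R) 2 + fromℕ 128 * pow (rr R) 3) ∎

  powerSum : Carrier → ℕ → Carrier
  powerSum R k = pow R k + pow (1# - R) k

  defect : Carrier → ℕ → Carrier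
  defect R k = powerSum R k + fromℕ k * rr R - 1#

  clearedForm : (P D r K C₂ C₄ : Carrier) → Carrier
  clearedForm P D r K C₂ C₄ =
    fromℕ 960 - fromℕ 240 * K - fromℕ 1920 * (P + D)
    + K * (C₂ * (fromℕ 10 + fromℕ 320 * pow r 2) - C₄ * (fromℕ 3 + fromℕ 64 * pow r 2 + fromℕ 128 * pow r 3))

  fromℕ*ϱ̃ : ∀ R k → let K = fromℕ (suc k) in
    K * ϱ̃ R (suc k) ≈ half - pow half (suc k) + (1# - powerSum R (suc k))
                      + K * (σ₁ R + fromℕ (k C 2) * σ₃ R + fromℕ (k C 4) * σ₅ R)
  fromℕ*ϱ̃ R k = trans (*-inv-distrib _ _ _ _ _ _ (fromℕ-*-inv (suc k)))
    (+-congʳ (solve 5 (λ h P R pR pS → h :- P :+ (R :- pR) :+ ((# 1 :- R) :- pS) := h :- P :+ (# 1 :- (pR :+ pS)))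
                      refl half (pow half (suc k)) R (pow R (suc k)) (pow (1# - R) (suc k))))

  1920*fromℕ*ϱ̃≈clearedForm : ∀ R k → let K = fromℕ (suc k) in
    fromℕ 1920 * (K * ϱ̃ R (suc k))
      ≈ clearedForm (pow half (suc k)) (defect R (suc k)) (rr R) K (fromℕ (k C 2)) (fromℕ (k C 4))
  1920*fromℕ*ϱ̃≈clearedForm R k = begin
    N * (K * ϱ̃ R (suc k))
      ≈⟨ *-congˡ (fromℕ*ϱ̃ R k) ⟩
    N * (half - P + (1# - S) + K * (σ₁ R + C₂ * σ₃ R + C₄ * σ₅ R))
      ≈⟨ solve 9 (λ h P S K s₁ s₃ s₅ C₂ C₄ →
                    # 1920 :* (h :- P :+ (# 1 :- S) :+ K :* (s₁ :+ C₂ :* s₃ :+ C₄ :* s₅))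
                 := # 1920 :* h :- # 1920 :* P :+ # 1920 :* (# 1 :- S)
                    :+ K :* (# 1920 :* s₁ :+ C₂ :* (# 1920 :* s₃) :+ C₄ :* (# 1920 :* s₅)))
               refl half P S K (σ₁ R) (σ₃ R) (σ₅ R) C₂ C₄ ⟩
    N * half - N * P + N * (1# - S) + K * (N * σ₁ R + C₂ * (N * σ₃ R) + C₄ * (N * σ₅ R))
      ≈⟨ +-cong (+-congʳ (+-congʳ 1920*half))
                (*-congˡ (+-cong (+-cong (1920*σ₁ R) (*-congˡ (1920*σ₃ R))) (*-congˡ (1920*σ₅ R)))) ⟩
    fromℕ 960 - N * P + N * (1# - S)
      + K * (- (fromℕ 240 + N * r) + C₂ * (fromℕ 10 + fromℕ 320 * pow r 2)
             + C₄ * - (fromℕ 3 + fromℕ 64 * pow r 2 + fromℕ 128 * pow r 3))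
      ≈⟨ solve 6 (λ P S r K C₂ C₄ →
                    # 960 :- # 1920 :* P :+ # 1920 :* (# 1 :- S)
                    :+ K :* (:- (# 240 :+ # 1920 :* r) :+ C₂ :* (# 10 :+ # 320 :* r :^ 2)
                             :+ C₄ :* :- (# 3 :+ # 64 :* r :^ 2 :+ # 128 :* r :^ 3))
                 := # 960 :- # 240 :* K :- # 1920 :* (P :+ (S :+ K :* r :- # 1))
                    :+ K :* (C₂ :* (# 10 :+ # 320 :* r :^ 2)
                             :- C₄ :* (# 3 :+ # 64 :* r :^ 2 :+ # 128 :* r :^ 3)))
               refl P S r K C₂ C₄ ⟩
    clearedForm P (defect R (suc k)) r K C₂ C₄ ∎
    where
    N K P S r C₂ C₄ : Carrier
    N  = fromℕ 1920
    K  = fromℕ (suc k)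
    P  = pow half (suc k)
    S  = powerSum R (suc k)
    r  = rr R
    C₂ = fromℕ (k C 2)
    C₄ = fromℕ (k C 4)

  clearedForm-cong : ∀ P D r C₂ {K K′ C₄ C₄′} → K ≈ K′ → C₄ ≈ C₄′ →
    clearedForm P D r K C₂ C₄ ≈ clearedForm P D r K′ C₂ C₄′
  clearedForm-cong P D r C₂ K≈K′ C₄≈C₄′ =
    +-cong (+-congʳ (+-congˡ (-‿cong (*-congˡ K≈K′))))
           (*-cong K≈K′ (+-congˡ (-‿cong (*-congʳ C₄≈C₄′))))

  clearedForm-12+ : ∀ P D r M C₂ d →
    clearedForm P D r (fromℕ 12 + M) C₂ (fromℕ 5 * C₂ + d)
      ≈ - (fromℕ 1920 + fromℕ 240 * M + fromℕ 1920 * (P + D)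
           + (fromℕ 12 + M) * (C₂ * (fromℕ 5 + fromℕ 640 * pow r 3)
                               + d * (fromℕ 3 + fromℕ 64 * pow r 2 + fromℕ 128 * pow r 3)))
  clearedForm-12+ = solve 6 (λ P D r M C₂ d →
      # 960 :- # 240 :* (# 12 :+ M) :- # 1920 :* (P :+ D)
      :+ (# 12 :+ M) :* (C₂ :* (# 10 :+ # 320 :* r :^ 2) :- (# 5 :* C₂ :+ d) :* (# 3 :+ # 64 :* r :^ 2 :+ # 128 :* r :^ 3))
    := :- (# 1920 :+ # 240 :* M :+ # 1920 :* (P :+ D)
           :+ (# 12 :+ M) :* (C₂ :* (# 5 :+ # 640 :* r :^ 3) :+ d :* (# 3 :+ # 64 :* r :^ 2 :+ # 128 :* r :^ 3))))
    refl

  1920*[12+m]*ϱ̃ : ∀ R m d → let n = 11 ℕ.+ m in 5 ℕ.* (n C 2) ℕ.+ d ≡ n C 4 →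
    fromℕ 1920 * (fromℕ (suc n) * ϱ̃ R (suc n))
      ≈ - (fromℕ 1920 + fromℕ 240 * fromℕ m + fromℕ 1920 * (pow half (suc n) + defect R (suc n))
           + (fromℕ 12 + fromℕ m) * (fromℕ (n C 2) * (fromℕ 5 + fromℕ 640 * pow (rr R) 3)
                                     + fromℕ d * (fromℕ 3 + fromℕ 64 * pow (rr R) 2 + fromℕ 128 * pow (rr R) 3)))
  1920*[12+m]*ϱ̃ R m d 5C₂+d≡C₄ = begin
    fromℕ 1920 * (fromℕ (suc n) * ϱ̃ R (suc n))
      ≈⟨ 1920*fromℕ*ϱ̃≈clearedForm R n ⟩
    clearedForm P D r (fromℕ (12 ℕ.+ m)) C₂ (fromℕ (n C 4))
      ≈⟨ clearedForm-cong P D r C₂ (fromℕ-+ 12 m) C₄≈ ⟩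
    clearedForm P D r (fromℕ 12 + fromℕ m) C₂ (fromℕ 5 * C₂ + fromℕ d)
      ≈⟨ clearedForm-12+ P D r (fromℕ m) C₂ (fromℕ d) ⟩
    _ ∎
    where
    n : ℕ
    n  = 11 ℕ.+ m
    P D r C₂ : Carrier
    P  = pow half (suc n)
    D  = defect R (suc n)
    r  = rr R
    C₂ = fromℕ (n C 2)
    C₄≈ : fromℕ (n C 4) ≈ fromℕ 5 * C₂ + fromℕ d
    C₄≈ = begin
      fromℕ (n C 4)                       ≡⟨ ≡.cong fromℕ 5C₂+d≡C₄ ⟨
      fromℕ (5 ℕ.* (n C 2) ℕ.+ d)         ≈⟨ fromℕ-+ (5 ℕ.* (n C 2)) d ⟩
      fromℕ (5 ℕ.* (n C 2)) + fromℕ d     ≈⟨ +-congʳ (fromℕ-* 5 (n C 2)) ⟩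
      fromℕ 5 * C₂ + fromℕ d              ∎

  positivityCertificate : (a₀ a₂ a₃ a₄ b : ℕ) → Carrier → Carrier
  positivityCertificate a₀ a₂ a₃ a₄ b R =
    fromℕ a₀ + fromℕ a₂ * pow r 2 + fromℕ a₃ * pow r 3 + fromℕ a₄ * pow r 4
    + fromℕ b * pow r 4 * pow (1# - fromℕ 2 * R) 2
    where
    r : Carrier
    r = rr R

  Cleared : ∀ {n} → ℕ → Polynomial n → Polynomial n → Polynomial n
  Cleared k R P =
    # 960 :- # 240 :* K :- # 1920 :* (P :+ (R :^ k :+ (# 1 :- R) :^ k :+ K :* r :- # 1))
    :+ K :* (# ((k ∸ 1) C 2) :* (# 10 :+ # 320 :* r :^ 2) :- # ((k ∸ 1) C 4) :* (# 3 :+ # 64 :* r :^ 2 :+ # 128 :* r :^ 3))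
    where
    K r : Polynomial _
    K = # k
    r = R :* (# 1 :- R)

  Certificate : ∀ {n} → (a₀ a₂ a₃ a₄ b : ℕ) → Polynomial n → Polynomial n
  Certificate a₀ a₂ a₃ a₄ b R =
    # a₀ :+ # a₂ :* r :^ 2 :+ # a₃ :* r :^ 3 :+ # a₄ :* r :^ 4 :+ # b :* r :^ 4 :* (# 1 :- # 2 :* R) :^ 2
    where
    r : Polynomial _
    r = R :* (# 1 :- R)

  1920*8*ϱ̃ : ∀ R →
    fromℕ 1920 * (fromℕ 8 * ϱ̃ R 8)
      ≈ - (fromℕ 1920 * pow half 8 + positivityCertificate 120 2560 5120 3840 0 R)
  1920*8*ϱ̃ R = trans (1920*fromℕ*ϱ̃≈clearedForm R 7)
    (solve 2 (λ R P → Cleared 8 R P := :- (# 1920 :* P :+ Certificate 120 2560 5120 3840 0 R)) refl R (pow half 8))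

  1920*9*ϱ̃ : ∀ R →
    fromℕ 1920 * (fromℕ 9 * ϱ̃ R 9)
      ≈ - (fromℕ 1920 * pow half 9 + positivityCertificate 570 11520 23040 17280 0 R)
  1920*9*ϱ̃ R = trans (1920*fromℕ*ϱ̃≈clearedForm R 8)
    (solve 2 (λ R P → Cleared 9 R P := :- (# 1920 :* P :+ Certificate 570 11520 23040 17280 0 R)) refl R (pow half 9))

  1920*10*ϱ̃ : ∀ R →
    fromℕ 1920 * (fromℕ 10 * ϱ̃ R 10)
      ≈ - (fromℕ 1920 * pow half 10 + positivityCertificate 1620 32640 65280 47040 960 R)
  1920*10*ϱ̃ R = trans (1920*fromℕ*ϱ̃≈clearedForm R 9)
    (solve 2 (λ R P → Cleared 10 R P := :- (# 1920 :* P :+ Certificate 1620 32640 65280 47040 960 R)) refl R (pow half 10))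

  1920*11*ϱ̃ : ∀ R →
    fromℕ 1920 * (fromℕ 11 * ϱ̃ R 11)
      ≈ - (fromℕ 1920 * pow half 11 + positivityCertificate 3660 73920 147840 100320 5280 R)
  1920*11*ϱ̃ R = trans (1920*fromℕ*ϱ̃≈clearedForm R 10)
    (solve 2 (λ R P → Cleared 11 R P := :- (# 1920 :* P :+ Certificate 3660 73920 147840 100320 5280 R)) refl R (pow half 11))

  cleared-neg⇒neg : ∀ k {x M} → 0# < M → fromℕ 1920 * (fromℕ (suc k) * x) ≈ - M → x < 0#
  cleared-neg⇒neg k 0<M eq =
    pos-*-cancelˡ-neg (fromℕ-pos (suc k)) (pos-*-cancelˡ-neg (fromℕ-pos 1920) (<-respˡ-≈ (sym eq) (pos-neg 0<M)))

  module _ {R : Carrier} (0≤R : 0# ≤ R) (R≤1 : R ≤ 1#) where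

    r-nonneg : 0# ≤ rr R
    r-nonneg = nonneg-* 0≤R (1-x-nonneg R≤1)

    fromℕ*r^-nonneg : ∀ a i → 0# ≤ fromℕ a * pow (rr R) i
    fromℕ*r^-nonneg a i = nonneg-* (fromℕ-nonneg a) (pow-nonneg i r-nonneg)

    1-powerSum-nonneg : ∀ j → 0# ≤ 1# - powerSum R (suc j)
    1-powerSum-nonneg zero = inj₂ (sym (solve 1 (λ R → # 1 :- (R :* # 1 :+ (# 1 :- R) :* # 1) := # 0) refl R))
    1-powerSum-nonneg (suc j) = ≤-respʳ-≈
      (nonneg-+ (1-powerSum-nonneg j)
                (nonneg-+ (nonneg-* (pow-nonneg (suc j) 0≤R) (1-x-nonneg R≤1))
                          (nonneg-* (pow-nonneg (suc j) (1-x-nonneg R≤1)) 0≤R)))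
      (solve 3 (λ R a b → # 1 :- (a :+ b) :+ (a :* (# 1 :- R) :+ b :* R)
                       := # 1 :- (R :* a :+ (# 1 :- R) :* b))
             refl R (pow R (suc j)) (pow (1# - R) (suc j)))

    defect-nonneg : ∀ j → 0# ≤ defect R (suc (suc j))
    defect-nonneg zero = inj₂ (sym (solve 1 (λ R → R :* (R :* # 1) :+ (# 1 :- R) :* ((# 1 :- R) :* # 1)
                                                 :+ # 2 :* (R :* (# 1 :- R)) :- # 1 := # 0) refl R))
    defect-nonneg (suc j) = ≤-respʳ-≈
      (nonneg-+ (defect-nonneg j) (nonneg-* r-nonneg (1-powerSum-nonneg j)))
      (solve 4 (λ R a b f → R :* a :+ (# 1 :- R) :* b :+ f :* (R :* (# 1 :- R)) :- # 1 :+ R :* (# 1 :- R) :* (# 1 :- (a :+ b))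
                         := R :* (R :* a) :+ (# 1 :- R) :* ((# 1 :- R) :* b) :+ (# 1 :+ f) :* (R :* (# 1 :- R)) :- # 1)
             refl R (pow R (suc j)) (pow (1# - R) (suc j)) (fromℕ (suc (suc j))))

    positivityCertificate-pos : ∀ a₀ a₂ a₃ a₄ b .{{_ : ℕ.NonZero a₀}} →
      0# < positivityCertificate a₀ a₂ a₃ a₄ b R
    positivityCertificate-pos a₀ a₂ a₃ a₄ b =
      pos-+-nonneg (pos-+-nonneg (pos-+-nonneg (pos-+-nonneg (fromℕ-pos a₀)
        (fromℕ*r^-nonneg a₂ 2)) (fromℕ*r^-nonneg a₃ 3)) (fromℕ*r^-nonneg a₄ 4))
        (nonneg-* (fromℕ*r^-nonneg b 4) (square-nonneg (1# - fromℕ 2 * R)))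

    ϱ̃<0-byCertificate : ∀ k a₀ a₂ a₃ a₄ b .{{_ : ℕ.NonZero a₀}} →
      fromℕ 1920 * (fromℕ (suc k) * ϱ̃ R (suc k))
        ≈ - (fromℕ 1920 * pow half (suc k) + positivityCertificate a₀ a₂ a₃ a₄ b R) →
      ϱ̃ R (suc k) < 0#
    ϱ̃<0-byCertificate k a₀ a₂ a₃ a₄ b =
      cleared-neg⇒neg k (nonneg-+-pos (nonneg-* (fromℕ-nonneg 1920) (pow-nonneg (suc k) half-nonneg))
                                      (positivityCertificate-pos a₀ a₂ a₃ a₄ b))

    ϱ̃<0 : ∀ m → ϱ̃ R (8 ℕ.+ m) < 0#
    ϱ̃<0 0 = ϱ̃<0-byCertificate 7 120 2560 5120 3840 0 (1920*8*ϱ̃ R)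
    ϱ̃<0 1 = ϱ̃<0-byCertificate 8 570 11520 23040 17280 0 (1920*9*ϱ̃ R)
    ϱ̃<0 2 = ϱ̃<0-byCertificate 9 1620 32640 65280 47040 960 (1920*10*ϱ̃ R)
    ϱ̃<0 3 = ϱ̃<0-byCertificate 10 3660 73920 147840 100320 5280 (1920*11*ϱ̃ R)
    ϱ̃<0 (suc (suc (suc (suc m)))) with ℕP.m≤n⇒∃[o]m+o≡n (5*C₂≤C₄ m)
    ... | d , 5C₂+d≡C₄ = cleared-neg⇒neg (11 ℕ.+ m)
      (pos-+-nonneg
        (pos-+-nonneg (pos-+-nonneg (fromℕ-pos 1920) (nonneg-* (fromℕ-nonneg 240) (fromℕ-nonneg m)))
                      (nonneg-* (fromℕ-nonneg 1920) (nonneg-+ (pow-nonneg (12 ℕ.+ m) half-nonneg) (defect-nonneg (10 ℕ.+ m)))))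
        (nonneg-* (nonneg-+ (fromℕ-nonneg 12) (fromℕ-nonneg m))
                  (nonneg-+ (nonneg-* (fromℕ-nonneg ((11 ℕ.+ m) C 2)) (nonneg-+ (fromℕ-nonneg 5) (fromℕ*r^-nonneg 640 3)))
                            (nonneg-* (fromℕ-nonneg d)
                                      (nonneg-+ (nonneg-+ (fromℕ-nonneg 3) (fromℕ*r^-nonneg 64 2)) (fromℕ*r^-nonneg 128 3))))))
      (1920*[12+m]*ϱ̃ R m d 5C₂+d≡C₄)

lemma9 : ∀ {c ℓ₁ ℓ₂} (F : OrderedField c ℓ₁ ℓ₂) → Lemma9Claim F
lemma9 F R 0≤R R≤1 k 8≤k with ℕP.m≤n⇒∃[o]m+o≡n 8≤k
... | m , ≡.refl = Lemma9.ϱ̃<0 F 0≤R R≤1 m
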